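{- Let $G$ and $H$ be graphs such that the direct product $G\times H$ is a balanced distance magic graph, and let $\ell$ be a balanced distance magic labeling of $G\times H$ in which $(g,h)$ and $(g',h)$ are twin vertices and also $(g,h_1)$ and $(g,h_2)$ are twin vertices. Then the labeling obtained from $\ell$ by exchanging the labels of $(g,h_2)$ and $(g',h_1)$ is a balanced distance magic labeling of $G\times H$ in which $(g,h_1)$ and $(g',h_1)$ are twin vertices.
   Context: All graphs are finite and simple; $N(x)$ is the open neighborhood of $x$. A distance magic labeling of a graph $X$ of order $n$ is a bijection $\ell\colon V(X)\to\{1,\ldots,n\}$ for which there is a positive integer $k$ with $\sum_{y\in N(x)}\ell(y)=k$ for every vertex $x$. A distance magic graph $X$ with an even number of vertices is balanced if there exists a bijection $\ell\colon V(X)\to\{1,\ldots,|V(X)|\}$ such that for every $w\in V(X)$: whenever $u\in N(w)$ has $\ell(u)=i$, there exists $v\in N(w)$ with $\ell(v)=|V(X)|+1-i$; such $\ell$ is a balanced distance magic labeling. For such a labeling, two vertices $u,v$ with $\ell(u)+\ell(v)=|V(X)|+1$ are called twin vertices (twins). The direct product $G\times H$ has vertex set $V(G)\times V(H)$, with $(g,h)$ adjacent to $(g',h')$ iff $gg'\in E(G)$ and $hh'\in E(H)$. -}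

module Defs where

open import Data.Nat using (ℕ; zero; suc; _+_; _*_; _<_)
open import Data.Nat.ListAction using (sum)
open import Data.Bool using (Bool; true; false; if_then_else_; _∧_)
open import Data.Fin using (Fin; toℕ; combine; remQuot; _≟_)
open import Data.List using (map; allFin)
open import Data.Product using (Σ; ∃; _×_; _,_; proj₁; proj₂)
open import Function.Definitions using (Bijective)
open import Relation.Nullary using (yes; no)
open import Relation.Binary.PropositionalEquality using (_≡_; refl)

record Graph : Set where
  field
    order  : ℕ
    adj    : Fin order → Fin order → Bool
    sym    : ∀ x y → adj x y ≡ adj y x
    irrefl : ∀ x → adj x x ≡ false
open Graph public

-- Direct product G × H.  Its vertex set Fin (|G| * |H|) is identified
-- with Fin |G| × Fin |H| via the standard bijection combine / remQuot.
-- adjacency in the direct product, on pairs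
prodAdj : (G H : Graph) → Fin (order G) × Fin (order H) → Fin (order G) × Fin (order H) → Bool
prodAdj G H (g , h) (g' , h') = adj G g g' ∧ adj H h h'

prodAdj-sym : (G H : Graph) → ∀ p q → prodAdj G H p q ≡ prodAdj G H q p
prodAdj-sym G H (g , h) (g' , h') rewrite Graph.sym G g g' | Graph.sym H h h' = refl

prodAdj-irrefl : (G H : Graph) → ∀ p → prodAdj G H p p ≡ false
prodAdj-irrefl G H (g , h) rewrite Graph.irrefl G g = refl

_⊗_ : Graph → Graph → Graph
order (G ⊗ H) = order G * order H
adj   (G ⊗ H) x y = prodAdj G H (remQuot (order H) x) (remQuot (order H) y)
sym   (G ⊗ H) x y = prodAdj-sym G H (remQuot (order H) x) (remQuot (order H) y)
irrefl (G ⊗ H) x = prodAdj-irrefl G H (remQuot (order H) x)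

⟨_,_⟩ : ∀ {G H : Graph} → Fin (order G) → Fin (order H) → Fin (order (G ⊗ H))
⟨ g , h ⟩ = combine g h

-- A labeling is a map  ℓ : V → Fin n ; the label of x is  ℓ x + 1,
-- so a bijection  V → Fin n  is a bijection  V → {1,…,n}.
Labeling : Graph → Set
Labeling X = Fin (order X) → Fin (order X)

label : ∀ {X : Graph} → Labeling X → Fin (order X) → ℕ
label ℓ x = suc (toℕ (ℓ x))

neighSum : (X : Graph) → Labeling X → Fin (order X) → ℕ
neighSum X ℓ x = sum (map (λ y → if adj X x y then label {X} ℓ y else 0) (allFin (order X)))

IsDistanceMagicLabeling : (X : Graph) → Labeling X → Set
IsDistanceMagicLabeling X ℓ =
  Bijective _≡_ _≡_ ℓ × Σ ℕ (λ k → 0 < k × (∀ x → neighSum X ℓ x ≡ k))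

IsDistanceMagic : Graph → Set
IsDistanceMagic X = Σ (Labeling X) (IsDistanceMagicLabeling X)

Balanced : (X : Graph) → Labeling X → Set
Balanced X ℓ = ∀ w u → adj X w u ≡ true →
  Σ (Fin (order X)) (λ v → adj X w v ≡ true × label {X} ℓ u + label {X} ℓ v ≡ order X + 1)

IsBalancedDistanceMagicLabeling : (X : Graph) → Labeling X → Set
IsBalancedDistanceMagicLabeling X ℓ = IsDistanceMagicLabeling X ℓ × Balanced X ℓ

IsBalancedDistanceMagic : Graph → Set
IsBalancedDistanceMagic X =
  IsDistanceMagic X × Σ ℕ (λ m → order X ≡ m + m) × Σ (Labeling X) (IsBalancedDistanceMagicLabeling X)

Twins : (X : Graph) → Labeling X → Fin (order X) → Fin (order X) → Set
Twins X ℓ u v = label {X} ℓ u + label {X} ℓ v ≡ order X + 1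

exchange : ∀ {n} → (Fin n → Fin n) → Fin n → Fin n → Fin n → Fin n
exchange ℓ a b x with x ≟ a
... | yes _ = ℓ b
... | no _ with x ≟ b
...   | yes _ = ℓ a
...   | no _ = ℓ x

module Submission where

-- In a balanced distance magic labeling every vertex u has
-- at most one twin, and the balancing condition forces the twin of u to
-- lie in every neighbourhood containing u: twins have the same open
-- neighbourhood.  In a direct product, N(g,h) = N(g) × N(h), and every
-- vertex of G × H has a neighbour (the magic constant is positive), so
-- the twins (g,h),(g',h) give N(g) = N(g') and the twins (g,h₁),(g,h₂)
-- give N(h₁) = N(h₂).  Hence (g,h₂) and (g',h₁) have the same
-- neighbourhood, and exchanging the labels of two vertices with the same
-- neighbourhood is a permutation of labels inside every neighbourhood,
-- so it preserves bijectivity, the magic sums and the balancing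
-- condition.  Finally (g',h₁) receives the old label of (g,h₂), the twin
-- of (g,h₁); the vertices involved are distinct because, the order being
-- even, no vertex is its own twin.

open import Defs
open import Data.Fin using (Fin)
open import Data.Product using (_×_)

open import Data.Nat using (ℕ; zero; suc; _+_; _<_)
open import Data.Nat.Properties using (+-suc; +-comm; +-cancelˡ-≡; suc-injective; +-0-commutativeMonoid)
open import Data.Nat.ListAction using (sum)
open import Data.Bool using (Bool; true; false; if_then_else_; _∧_)
open import Data.Bool.Properties using (∧-conicalˡ; ∧-conicalʳ; ∧-identityʳ)
open import Data.Fin as Fin using (toℕ; remQuot; _≟_)
open import Data.Fin.Properties using (toℕ-injective; remQuot-combine; combine-injectiveˡ)
open import Data.Fin.Permutation.Components using (transpose; transpose-inverse)
import Data.Fin.Permutation as Perm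
open import Algebra.Properties.CommutativeMonoid.Sum +-0-commutativeMonoid as FinSum
  using (sum-permute)
open import Data.List using (List; []; _∷_; map; allFin; tabulate)
open import Data.Product using (∃; ∃₂; _,_; proj₁; proj₂)
open import Data.Empty using (⊥-elim)
open import Relation.Nullary using (yes; no)
open import Relation.Binary.PropositionalEquality
  using (_≡_; _≢_; _≗_; refl; trans; cong; cong₂; subst; module ≡-Reasoning)
  renaming (sym to ≡-sym)
open import Function.Base using (_∘_; id)
open import Function.Definitions using (Bijective; Injective)
open import Function.Bundles using (Bijection)
open import Function.Properties.Inverse using (Inverse⇒Bijection)
import Function.Construct.Composition as Compose

-- A double is never odd; this is why no vertex is its own twin in a graph
-- of even order.
double≢odd : ∀ a m → a + a ≢ suc (m + m)
double≢odd zero    m       ()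
double≢odd (suc a) zero    e with trans (≡-sym (+-suc a a)) (suc-injective e)
... | ()
double≢odd (suc a) (suc m) e rewrite +-suc a a | +-suc m m =
  double≢odd a m (suc-injective (suc-injective e))

true-together⇒≡ : ∀ {a b : Bool} → (a ≡ true → b ≡ true) → (b ≡ true → a ≡ true) → a ≡ b
true-together⇒≡ {false} {false} _   _   = refl
true-together⇒≡ {false} {true}  _   b⇒a = b⇒a refl
true-together⇒≡ {true}  {false} a⇒b _   = ≡-sym (a⇒b refl)
true-together⇒≡ {true}  {true}  _   _   = refl

-- The list sum over a tabulation is the finite sum over Fin n; this lets
-- the neighbourhood sums be reindexed by a permutation.
sum-map-tabulate : ∀ {A : Set} n (f : A → ℕ) (g : Fin n → A) →
  sum (map f (tabulate g)) ≡ FinSum.sum (f ∘ g)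
sum-map-tabulate zero    f g = refl
sum-map-tabulate (suc n) f g = cong (f (g Fin.zero) +_) (sum-map-tabulate n f (g ∘ Fin.suc))

positive-sum⇒witness : ∀ {A : Set} (p : A → Bool) (f : A → ℕ) (xs : List A) →
  0 < sum (map (λ y → if p y then f y else 0) xs) → ∃ λ y → p y ≡ true
positive-sum⇒witness p f []       ()
positive-sum⇒witness p f (x ∷ xs) pos with p x in px
... | true  = x , px
... | false = positive-sum⇒witness p f xs pos

bijective-≗ : ∀ {A B : Set} {f g : A → B} → f ≗ g →
  Bijective _≡_ _≡_ f → Bijective _≡_ _≡_ g
bijective-≗ {f = f} {g} f≗g (inj , surj) = inj′ , surj′
  where
  inj′ : ∀ {x y} → g x ≡ g y → x ≡ y
  inj′ {x} {y} e = inj (trans (f≗g x) (trans e (≡-sym (f≗g y))))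
  surj′ : ∀ y → ∃ λ x → ∀ {z} → z ≡ x → g z ≡ y
  surj′ y with surj y
  ... | x , fx = x , λ {z} z≡x → trans (≡-sym (f≗g z)) (fx z≡x)

exchange≗transpose : ∀ {n} (ℓ : Fin n → Fin n) a b → exchange ℓ a b ≗ ℓ ∘ transpose a b
exchange≗transpose ℓ a b x with x ≟ a
... | yes _ = refl
... | no _ with x ≟ b
...   | yes _ = refl
...   | no _  = refl

exchange-elsewhere : ∀ {n} (ℓ : Fin n → Fin n) {a b x} → x ≢ a → x ≢ b → exchange ℓ a b x ≡ ℓ x
exchange-elsewhere ℓ {a} {b} {x} x≢a x≢b with x ≟ a
... | yes x≡a = ⊥-elim (x≢a x≡a)
... | no _ with x ≟ b
...   | yes x≡b = ⊥-elim (x≢b x≡b)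
...   | no _    = refl

exchange-at-second : ∀ {n} (ℓ : Fin n → Fin n) {a b} → b ≢ a → exchange ℓ a b b ≡ ℓ a
exchange-at-second ℓ {a} {b} b≢a with b ≟ a
... | yes b≡a = ⊥-elim (b≢a b≡a)
... | no _ with b ≟ b
...   | yes _   = refl
...   | no b≢b  = ⊥-elim (b≢b refl)

SameNeighbourhood : (X : Graph) → Fin (order X) → Fin (order X) → Set
SameNeighbourhood X a b = ∀ w → adj X w a ≡ adj X w b

transpose-preserves-adj : (X : Graph) {a b : Fin (order X)} → SameNeighbourhood X a b →
  ∀ w x → adj X w (transpose a b x) ≡ adj X w x
transpose-preserves-adj X {a} {b} N-ab w x with x ≟ a
... | yes refl = ≡-sym (N-ab w)
... | no _ with x ≟ b
...   | yes refl = N-ab w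
...   | no _     = refl

module Exchange (X : Graph) {a b : Fin (order X)} (N-ab : SameNeighbourhood X a b)
                (ℓ : Labeling X) where

  -- Each neighbourhood sum is unchanged: it is the same sum reindexed
  -- by the transposition.
  exchange-neighSum : ∀ x → neighSum X (exchange ℓ a b) x ≡ neighSum X ℓ x
  exchange-neighSum x = begin
      neighSum X (exchange ℓ a b) x
    ≡⟨ sum-map-tabulate (order X) _ id ⟩
      FinSum.sum (λ y → if adj X x y then label {X} (exchange ℓ a b) y else 0)
    ≡⟨ FinSum.sum-cong-≗ reindex ⟩
      FinSum.sum (term ∘ transpose a b)
    ≡⟨ ≡-sym (sum-permute term (Perm.transpose a b)) ⟩
      FinSum.sum term
    ≡⟨ ≡-sym (sum-map-tabulate (order X) _ id) ⟩
      neighSum X ℓ x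
    ∎
    where
    open ≡-Reasoning
    term : Fin (order X) → ℕ
    term y = if adj X x y then label {X} ℓ y else 0
    reindex : ∀ y → (if adj X x y then label {X} (exchange ℓ a b) y else 0) ≡ term (transpose a b y)
    reindex y rewrite transpose-preserves-adj X N-ab x y | exchange≗transpose ℓ a b y = refl

  -- The exchanged labeling is ℓ composed with a permutation.
  exchange-bijective : Bijective _≡_ _≡_ ℓ → Bijective _≡_ _≡_ (exchange ℓ a b)
  exchange-bijective bij = bijective-≗ (λ x → ≡-sym (exchange≗transpose ℓ a b x))
    (Compose.bijective _≡_ _≡_ _≡_
      (Bijection.bijective (Inverse⇒Bijection (Perm.transpose a b))) bij)

  -- The partner of u for ℓ, moved by the transposition, is a partner of
  -- u for the exchanged labeling.
  exchange-balanced : Balanced X ℓ → Balanced X (exchange ℓ a b)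
  exchange-balanced bal w u wu with bal w (transpose a b u) (trans (transpose-preserves-adj X N-ab w u) wu)
  ... | v , wv , twins = transpose b a v , adj-wv′ , twins′
    where
    N-ba : SameNeighbourhood X b a
    N-ba w = ≡-sym (N-ab w)
    adj-wv′ : adj X w (transpose b a v) ≡ true
    adj-wv′ = trans (transpose-preserves-adj X N-ba w v) wv
    label-v′ : exchange ℓ a b (transpose b a v) ≡ ℓ v
    label-v′ = trans (exchange≗transpose ℓ a b (transpose b a v)) (cong ℓ (transpose-inverse a b))
    twins′ : label {X} (exchange ℓ a b) u + label {X} (exchange ℓ a b) (transpose b a v) ≡ order X + 1
    twins′ = trans (cong₂ (λ p q → suc (toℕ p) + suc (toℕ q)) (exchange≗transpose ℓ a b u) label-v′) twins

  exchange-preserves-bdm : IsBalancedDistanceMagicLabeling X ℓ →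
    IsBalancedDistanceMagicLabeling X (exchange ℓ a b)
  exchange-preserves-bdm ((bij , k , k>0 , magic) , bal) =
    (exchange-bijective bij , k , k>0 , λ x → trans (exchange-neighSum x) (magic x)) ,
    exchange-balanced bal

exchange-twins : (X : Graph) (ℓ : Labeling X) {u a b : Fin (order X)} → Twins X ℓ u a →
  u ≢ a → u ≢ b → b ≢ a → Twins X (exchange ℓ a b) u b
exchange-twins X ℓ twins u≢a u≢b b≢a =
  trans (cong₂ (λ p q → suc (toℕ p) + suc (toℕ q))
               (exchange-elsewhere ℓ u≢a u≢b) (exchange-at-second ℓ b≢a))
        twins

module TwinFacts (X : Graph) (ℓ : Labeling X) where

  twins-sym : ∀ {u v} → Twins X ℓ u v → Twins X ℓ v u
  twins-sym {u} {v} t = trans (+-comm (label {X} ℓ v) (label {X} ℓ u)) t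

  twin-unique : Injective _≡_ _≡_ ℓ → ∀ {u v v′} →
    Twins X ℓ u v → Twins X ℓ u v′ → v ≡ v′
  twin-unique inj {u} t t′ =
    inj (toℕ-injective (suc-injective (+-cancelˡ-≡ (label {X} ℓ u) _ _ (trans t (≡-sym t′)))))

  -- In a balanced labeling the twin of u lies in every neighbourhood
  -- that contains u, so twins have the same neighbourhood.
  twins-same-neighbourhood : Injective _≡_ _≡_ ℓ → Balanced X ℓ →
    ∀ {u v} → Twins X ℓ u v → SameNeighbourhood X u v
  twins-same-neighbourhood inj bal t w =
    true-together⇒≡ (twin-adjacent t) (twin-adjacent (twins-sym t))
    where
    twin-adjacent : ∀ {u v} → Twins X ℓ u v → adj X w u ≡ true → adj X w v ≡ true
    twin-adjacent t wu with bal w _ wu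
    ... | v′ , wv′ , t′ = subst (λ z → adj X w z ≡ true) (≡-sym (twin-unique inj t t′)) wv′

  twins-distinct : ∀ {m} → order X ≡ m + m → ∀ {u v} → Twins X ℓ u v → u ≢ v
  twins-distinct {m} even {u} t refl =
    double≢odd (label {X} ℓ u) m (trans t (trans (cong (_+ 1) even) (+-comm (m + m) 1)))

  magic-neighbour : IsDistanceMagicLabeling X ℓ → ∀ x → ∃ λ y → adj X x y ≡ true
  magic-neighbour (_ , k , k>0 , magic) x =
    positive-sum⇒witness (adj X x) (label {X} ℓ) (allFin (order X)) (subst (0 <_) (≡-sym (magic x)) k>0)

module Product (G H : Graph) where

  fst : Fin (order (G ⊗ H)) → Fin (order G)
  fst w = proj₁ (remQuot {order G} (order H) w)

  snd : Fin (order (G ⊗ H)) → Fin (order H)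
  snd w = proj₂ (remQuot {order G} (order H) w)

  adj-⊗ : ∀ w x y → adj (G ⊗ H) w (⟨_,_⟩ {G} {H} x y) ≡ adj G (fst w) x ∧ adj H (snd w) y
  adj-⊗ w x y = cong (prodAdj G H (remQuot {order G} (order H) w)) (remQuot-combine x y)

  adj-⊗-vertices : ∀ x y x′ y′ →
    adj (G ⊗ H) (⟨_,_⟩ {G} {H} x y) (⟨_,_⟩ {G} {H} x′ y′) ≡ adj G x x′ ∧ adj H y y′
  adj-⊗-vertices x y x′ y′ = cong₂ (prodAdj G H) (remQuot-combine x y) (remQuot-combine x′ y′)

  neighbour-factors : ∀ {g h w} → adj (G ⊗ H) (⟨_,_⟩ {G} {H} g h) w ≡ true →
    ∃₂ λ x y → adj G x g ≡ true × adj H y h ≡ true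
  neighbour-factors {g} {h} {w} gh-w =
    fst w , snd w , ∧-conicalˡ _ _ w-gh , ∧-conicalʳ _ _ w-gh
    where
    w-gh : adj G (fst w) g ∧ adj H (snd w) h ≡ true
    w-gh = trans (≡-sym (adj-⊗ w g h)) (trans (Graph.sym (G ⊗ H) w _) gh-w)

  -- N(g,h) = N(g) × N(h), so equal factor neighbourhoods give equal
  -- product neighbourhoods.
  same-neighbourhood-⊗ : ∀ {g g′ h h′} → SameNeighbourhood G g g′ → SameNeighbourhood H h h′ →
    SameNeighbourhood (G ⊗ H) (⟨_,_⟩ {G} {H} g h) (⟨_,_⟩ {G} {H} g′ h′)
  same-neighbourhood-⊗ {g} {g′} {h} {h′} N-g N-h w = begin
    adj (G ⊗ H) w (⟨_,_⟩ {G} {H} g h)      ≡⟨ adj-⊗ w g h ⟩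
    adj G (fst w) g ∧ adj H (snd w) h      ≡⟨ cong₂ _∧_ (N-g (fst w)) (N-h (snd w)) ⟩
    adj G (fst w) g′ ∧ adj H (snd w) h′    ≡⟨ ≡-sym (adj-⊗ w g′ h′) ⟩
    adj (G ⊗ H) w (⟨_,_⟩ {G} {H} g′ h′)    ∎
    where open ≡-Reasoning

  -- Conversely, when h has a neighbour y, testing against the vertices
  -- (x,y) recovers N(g) from N(g,h).
  same-neighbourhood-fst : ∀ {g g′ h y} → adj H y h ≡ true →
    SameNeighbourhood (G ⊗ H) (⟨_,_⟩ {G} {H} g h) (⟨_,_⟩ {G} {H} g′ h) → SameNeighbourhood G g g′
  same-neighbourhood-fst {g} {g′} {h} {y} y-h N x = begin
    adj G x g                 ≡⟨ ≡-sym (∧-identityʳ _) ⟩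
    adj G x g ∧ true          ≡⟨ cong (adj G x g ∧_) (≡-sym y-h) ⟩
    adj G x g ∧ adj H y h     ≡⟨ ≡-sym (adj-⊗-vertices x y g h) ⟩
    adj (G ⊗ H) (⟨_,_⟩ {G} {H} x y) (⟨_,_⟩ {G} {H} g h)    ≡⟨ N (⟨_,_⟩ {G} {H} x y) ⟩
    adj (G ⊗ H) (⟨_,_⟩ {G} {H} x y) (⟨_,_⟩ {G} {H} g′ h)   ≡⟨ adj-⊗-vertices x y g′ h ⟩
    adj G x g′ ∧ adj H y h    ≡⟨ cong (adj G x g′ ∧_) y-h ⟩
    adj G x g′ ∧ true         ≡⟨ ∧-identityʳ _ ⟩
    adj G x g′                ∎
    where open ≡-Reasoning

  -- Symmetrically, a neighbour x of g recovers N(h) from N(g,h).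
  same-neighbourhood-snd : ∀ {g h h′ x} → adj G x g ≡ true →
    SameNeighbourhood (G ⊗ H) (⟨_,_⟩ {G} {H} g h) (⟨_,_⟩ {G} {H} g h′) → SameNeighbourhood H h h′
  same-neighbourhood-snd {g} {h} {h′} {x} x-g N y = begin
    adj H y h                 ≡⟨⟩
    true ∧ adj H y h          ≡⟨ cong (_∧ adj H y h) (≡-sym x-g) ⟩
    adj G x g ∧ adj H y h     ≡⟨ ≡-sym (adj-⊗-vertices x y g h) ⟩
    adj (G ⊗ H) (⟨_,_⟩ {G} {H} x y) (⟨_,_⟩ {G} {H} g h)    ≡⟨ N (⟨_,_⟩ {G} {H} x y) ⟩
    adj (G ⊗ H) (⟨_,_⟩ {G} {H} x y) (⟨_,_⟩ {G} {H} g h′)   ≡⟨ adj-⊗-vertices x y g h′ ⟩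
    adj G x g ∧ adj H y h′    ≡⟨ cong (_∧ adj H y h′) x-g ⟩
    adj H y h′                ∎
    where open ≡-Reasoning

  vertex-≢ : ∀ {g g′ h h′} → g ≢ g′ → ⟨_,_⟩ {G} {H} g h ≢ ⟨_,_⟩ {G} {H} g′ h′
  vertex-≢ {g} {g′} {h} {h′} g≢g′ e = g≢g′ (combine-injectiveˡ g h g′ h′ e)

lemma2p3 : (G H : Graph) → IsBalancedDistanceMagic (G ⊗ H) →
  (ℓ : Labeling (G ⊗ H)) → IsBalancedDistanceMagicLabeling (G ⊗ H) ℓ →
  (g g' : Fin (order G)) (h h₁ h₂ : Fin (order H)) →
  Twins (G ⊗ H) ℓ (⟨_,_⟩ {G} {H} g h) (⟨_,_⟩ {G} {H} g' h) →
  Twins (G ⊗ H) ℓ (⟨_,_⟩ {G} {H} g h₁) (⟨_,_⟩ {G} {H} g h₂) →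
  IsBalancedDistanceMagicLabeling (G ⊗ H) (exchange ℓ (⟨_,_⟩ {G} {H} g h₂) (⟨_,_⟩ {G} {H} g' h₁))
    × Twins (G ⊗ H) (exchange ℓ (⟨_,_⟩ {G} {H} g h₂) (⟨_,_⟩ {G} {H} g' h₁))
        (⟨_,_⟩ {G} {H} g h₁) (⟨_,_⟩ {G} {H} g' h₁)
lemma2p3 G H (_ , (m , even) , _) ℓ bdm@(dm@((inj , _) , _) , bal) g g′ h h₁ h₂ t t₁₂ =
  Exchange.exchange-preserves-bdm (G ⊗ H) N-b₂-c ℓ bdm ,
  exchange-twins (G ⊗ H) ℓ t₁₂ (distinct t₁₂) (vertex-≢ g≢g′) (vertex-≢ (λ e → g≢g′ (≡-sym e)))
  where
  open Product G H
  open TwinFacts (G ⊗ H) ℓ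
  b₂ = ⟨_,_⟩ {G} {H} g h₂
  c  = ⟨_,_⟩ {G} {H} g′ h₁
  distinct : ∀ {u v} → Twins (G ⊗ H) ℓ u v → u ≢ v
  distinct = twins-distinct {m} even
  g≢g′ : g ≢ g′
  g≢g′ e = distinct t (cong (λ z → ⟨_,_⟩ {G} {H} z h) e)
  factors : ∃₂ λ x y → adj G x g ≡ true × adj H y h ≡ true
  factors = neighbour-factors (proj₂ (magic-neighbour dm (⟨_,_⟩ {G} {H} g h)))
  N-g : SameNeighbourhood G g g′
  N-g = same-neighbourhood-fst (proj₂ (proj₂ (proj₂ factors))) (twins-same-neighbourhood inj bal t)
  N-h : SameNeighbourhood H h₁ h₂
  N-h = same-neighbourhood-snd (proj₁ (proj₂ (proj₂ factors))) (twins-same-neighbourhood inj bal t₁₂)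
  N-b₂-c : SameNeighbourhood (G ⊗ H) b₂ c
  N-b₂-c = same-neighbourhood-⊗ N-g (λ y → ≡-sym (N-h y))
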